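{- Let $\mathcal{M}=(E,\mathcal{I})$ be a matroid, let $B_1$ and $B_2$ be two disjoint bases, let $\mathcal{C}$ be a cycle in the graph $D(B_1,B_2)$, and let $t\in V(\mathcal{C})$. Then there exists an exchangeable set $U\subseteq V(\mathcal{C})$ for $B_1$ and $B_2$ with $t\in U$. Moreover, if there is no cycle $\mathcal{C}'$ in $D(B_1,B_2)$ with $t\in V(\mathcal{C}')\subsetneq V(\mathcal{C})$, then $V(\mathcal{C})$ itself is an exchangeable set for $B_1$ and $B_2$.
   Context: $D(B_1,B_2)$ is the directed bipartite graph with vertex set $B_1\sqcup B_2$ and edges: $(x,y)$ for $x\in B_1$, $y\in B_2$ whenever $(B_1\setminus\{x\})\cup\{y\}$ is a basis, and $(y,x)$ for $y\in B_2$, $x\in B_1$ whenever $(B_2\setminus\{y\})\cup\{x\}$ is a basis. A cycle means a directed cycle; $V(\mathcal{C})$ is its vertex set. A set $X$ is an exchangeable set for $B_1$ and $B_2$ if $X\subseteq B_1\cup B_2$ and both $B_1\Delta X$ and $B_2\Delta X$ are bases. -}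

module Defs where

open import Data.Nat using (ℕ; _<_)
open import Data.Fin using (Fin)
open import Data.Fin.Subset using (Subset; ⊥; ⁅_⁆; _∈_; _∉_; _⊆_; _∪_; _∩_; _─_; _-_; ∣_∣; Empty)
open import Data.List using (List; []; _∷_; _∷ʳ_; foldr)
open import Data.List.Relation.Unary.Unique.Propositional using (Unique)
open import Data.List.Relation.Unary.Linked using (Linked)
open import Data.Product using (Σ; ∃; _×_)
open import Data.Sum using (_⊎_)
open import Data.Empty renaming (⊥ to ⊥ₑ)
open import Relation.Nullary using (¬_)
open import Relation.Binary.PropositionalEquality using (_≡_; _≢_)

record Matroid (n : ℕ) : Set₁ where
  field
    Indep      : Subset n → Set
    indep-∅    : Indep ⊥
    hereditary : ∀ {X Y} → Y ⊆ X → Indep X → Indep Y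
    augment    : ∀ {X Y} → Indep X → Indep Y → ∣ X ∣ < ∣ Y ∣ →
                 ∃ λ e → e ∈ Y × e ∉ X × Indep (X ∪ ⁅ e ⁆)
open Matroid public

module _ {n : ℕ} (M : Matroid n) where

  IsBasis : Subset n → Set
  IsBasis B = Indep M B × (∀ X → Indep M X → B ⊆ X → X ⊆ B)

  _Δ_ : Subset n → Subset n → Subset n
  X Δ Y = (X ─ Y) ∪ (Y ─ X)

  DEdge : Subset n → Subset n → Fin n → Fin n → Set
  DEdge B₁ B₂ u v =
      (u ∈ B₁ × v ∈ B₂ × IsBasis ((B₁ - u) ∪ ⁅ v ⁆))
    ⊎ (u ∈ B₂ × v ∈ B₁ × IsBasis ((B₂ - u) ∪ ⁅ v ⁆))

  Exchangeable : Subset n → Subset n → Subset n → Set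
  Exchangeable B₁ B₂ X = X ⊆ (B₁ ∪ B₂) × IsBasis (B₁ Δ X) × IsBasis (B₂ Δ X)

IsCycle : {n : ℕ} → (Fin n → Fin n → Set) → List (Fin n) → Set
IsCycle R []       = ⊥ₑ
IsCycle R (v ∷ vs) = Unique (v ∷ vs) × Linked R ((v ∷ vs) ∷ʳ v)

VSet : {n : ℕ} → List (Fin n) → Subset n
VSet = foldr (λ v S → ⁅ v ⁆ ∪ S) ⊥

_⊊_ : {n : ℕ} → Subset n → Subset n → Set
X ⊊ Y = X ⊆ Y × X ≢ Y

Disjoint : {n : ℕ} → Subset n → Subset n → Set
Disjoint X Y = Empty (X ∩ Y)

-- Say t ∈ B₁ (the case t ∈ B₂ is symmetric) and read the cycle from t = a₁ as a₁ b₁ a₂ b₂ … a_k b_k,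
-- so that every B₁ - aᵢ + bᵢ and every B₂ - bᵢ + aᵢ₊₁ (indices mod k) is a basis. Perform the
-- exchanges of B₁ one at a time, from the last pair backwards. Each step either succeeds, by the
-- augmentation axiom, or that axiom produces a basis B₁ - aᵢ + bⱼ with j > i. Such a chord
-- aᵢ → bⱼ skips bᵢ but neither end of the list, so it closes a cycle through t on fewer vertices.
-- Otherwise B₁ Δ V(C) is a basis. The same argument for B₂, with the list started at b₁ so that
-- t comes last, gives B₂ Δ V(C). So V(C) is exchangeable unless a smaller cycle through t exists:
-- induction on |V(C)| gives the first claim, and the dichotomy itself gives the second.
module Submission where

open import Defs
open import Data.Nat using (ℕ; suc; _≤_; _<_)
open import Data.Nat.Properties using (≤-trans; <-≤-trans; ≤-<-trans; ≤-reflexive; ≮⇒≥)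
open import Data.Nat.Induction using (<-wellFounded)
open import Induction.WellFounded using (Acc; acc)
open import Data.Fin using (Fin)
open import Data.Fin.Properties using (_≟_)
open import Data.Fin.Subset
  using (Subset; inside; outside; ⊥; ⁅_⁆; _∈_; _∉_; _⊆_; _⊂_; _∪_; _─_; _-_; ∣_∣)
open import Data.Fin.Subset.Properties
  using (_∈?_; ⊆-refl; ⊆-trans; ⊆-antisym; ∪-assoc; ∪-comm; ∪-identityˡ; p⊆p∪q; q⊆p∪q; p─q⊆p;
         p─⊥≡p; ∉⊥; x∈p∪q⁺; x∈p∪q⁻; x∈p∩q⁺; x∈⁅x⁆; x∈⁅y⁆⇒x≡y; x∉⁅y⁆⇒x≢y; x∈p∧x∉q⇒x∈p─q;
         x∈p∧x≢y⇒x∈p-y; x∈p⇒∣p-x∣<∣p∣; p⊂q⇒∣p∣<∣q∣)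
open import Data.Vec.Base using ([]; _∷_; here; there)
open import Data.List using (List; []; _∷_; _++_; [_]; _∷ʳ_)
open import Data.List.Properties using (++-assoc; ++-identityʳ; ∷-injectiveʳ)
open import Data.List.Membership.Propositional using () renaming (_∈_ to _∈ₗ_; _∉_ to _∉ₗ_)
open import Data.List.Membership.Propositional.Properties using (∈-++⁺ʳ; ∈-∃++)
open import Data.List.Relation.Unary.Any using (here; there)
open import Data.List.Relation.Unary.All using (_∷_)
open import Data.List.Relation.Unary.AllPairs using (AllPairs; []; _∷_)
open import Data.List.Relation.Unary.Linked as Linked using (Linked; [-]; _∷_)
open import Data.List.Relation.Unary.Unique.Propositional using (Unique)
open import Data.List.Relation.Unary.Unique.Propositional.Properties using (Unique[x∷xs]⇒x∉xs)
import Data.List.Relation.Binary.Sublist.Propositional as Sublist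
open Sublist using ([]; _∷_) renaming (_⊆_ to _⊑_; ⊆-refl to ⊑-refl)
open import Data.List.Relation.Binary.Sublist.Propositional.Properties
  using (All-resp-⊆; Any-resp-⊆; ++⁺; ++⁺ˡ)
import Data.List.Relation.Binary.Permutation.Setoid.Properties as Permutation
open import Data.Product using (∃; _×_; _,_; proj₁; proj₂; uncurry)
import Data.Product as Product
open import Data.Sum using (_⊎_; inj₁; inj₂)
import Data.Sum as Sum
open import Data.Empty using (⊥-elim)
open import Function using (_∘_; id)
open import Relation.Nullary using (¬_; yes; no)
open import Relation.Binary.PropositionalEquality
  using (_≡_; _≢_; refl; sym; trans; cong; subst; setoid; module ≡-Reasoning)

private
  variable
    n : ℕ
    A : Set
    a b b′ e h t x y z : A
    pre mid post xs ys ws C L : List A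
    p q B S V X : Subset n

x∈p─q⇒x∉q : ∀ (p q : Subset n) → x ∈ p ─ q → x ∉ q
x∈p─q⇒x∉q (_ ∷ p) (inside ∷ q) ()        here
x∈p─q⇒x∉q (_ ∷ p) (_      ∷ q) (there h) (there k) = x∈p─q⇒x∉q p q h k

x∈p-y∪⁅z⁆⁻ : ∀ (p : Subset n) → x ∈ (p - y) ∪ ⁅ z ⁆ → (x ∈ p × x ≢ y) ⊎ x ≡ z
x∈p-y∪⁅z⁆⁻ {y = y} {z = z} p x∈ with x∈p∪q⁻ (p - y) ⁅ z ⁆ x∈
... | inj₁ x∈p-y = inj₁ (p─q⊆p p ⁅ y ⁆ x∈p-y , x∉⁅y⁆⇒x≢y (x∈p─q⇒x∉q p ⁅ y ⁆ x∈p-y))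
... | inj₂ x∈⁅z⁆ = inj₂ (x∈⁅y⁆⇒x≡y z x∈⁅z⁆)

y∈p∪⁅y⁆ : ∀ (p : Subset n) y → y ∈ p ∪ ⁅ y ⁆
y∈p∪⁅y⁆ p y = q⊆p∪q p ⁅ y ⁆ (x∈⁅x⁆ y)

∣p∣≡1+∣p-x∣ : x ∈ p → ∣ p ∣ ≡ suc ∣ p - x ∣
∣p∣≡1+∣p-x∣ {p = inside  ∷ p} here      = cong suc (cong ∣_∣ (sym (p─⊥≡p p)))
∣p∣≡1+∣p-x∣ {p = inside  ∷ p} (there h) = cong suc (∣p∣≡1+∣p-x∣ h)
∣p∣≡1+∣p-x∣ {p = outside ∷ p} (there h) = ∣p∣≡1+∣p-x∣ h

x∈p─q∪q─p⁻ : ∀ (p q : Subset n) → x ∈ (p ─ q) ∪ (q ─ p) → (x ∈ p × x ∉ q) ⊎ (x ∈ q × x ∉ p)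
x∈p─q∪q─p⁻ p q = Sum.map (λ h → p─q⊆p p q h , x∈p─q⇒x∉q p q h) (λ h → p─q⊆p q p h , x∈p─q⇒x∉q q p h)
               ∘ x∈p∪q⁻ (p ─ q) (q ─ p)

x∈p─q∪q─p⁺ : (x ∈ p × x ∉ q) ⊎ (x ∈ q × x ∉ p) → x ∈ (p ─ q) ∪ (q ─ p)
x∈p─q∪q─p⁺ = x∈p∪q⁺ ∘ Sum.map (uncurry x∈p∧x∉q⇒x∈p─q) (uncurry x∈p∧x∉q⇒x∈p─q)

p─⊥∪⊥─p≡p : ∀ (p : Subset n) → (p ─ ⊥) ∪ (⊥ ─ p) ≡ p
p─⊥∪⊥─p≡p []            = refl
p─⊥∪⊥─p≡p (inside  ∷ p) = cong (inside ∷_) (p─⊥∪⊥─p≡p p)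
p─⊥∪⊥─p≡p (outside ∷ p) = cong (outside ∷_) (p─⊥∪⊥─p≡p p)

Δ-insert-pair : a ∈ B → b ∉ B → let W = ⁅ a ⁆ ∪ (⁅ b ⁆ ∪ V) in
                (B ─ W) ∪ (W ─ B) ≡ (((B ─ V) ∪ (V ─ B)) - a) ∪ ⁅ b ⁆
Δ-insert-pair {a = a} {B = B} {b = b} {V = V} a∈B b∉B = ⊆-antisym to from
  where
  W = ⁅ a ⁆ ∪ (⁅ b ⁆ ∪ V)
  W⁻ : x ∈ W → x ≡ a ⊎ x ≡ b ⊎ x ∈ V
  W⁻ x∈W with x∈p∪q⁻ ⁅ a ⁆ _ x∈W
  ... | inj₁ x∈⁅a⁆ = inj₁ (x∈⁅y⁆⇒x≡y a x∈⁅a⁆)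
  ... | inj₂ x∈bV  = inj₂ (Sum.map₁ (x∈⁅y⁆⇒x≡y b) (x∈p∪q⁻ ⁅ b ⁆ V x∈bV))
  V⊆W : V ⊆ W
  V⊆W = x∈p∪q⁺ ∘ inj₂ ∘ x∈p∪q⁺ ∘ inj₂
  to : (B ─ W) ∪ (W ─ B) ⊆ (((B ─ V) ∪ (V ─ B)) - a) ∪ ⁅ b ⁆
  to x∈ with x∈p─q∪q─p⁻ B W x∈
  ... | inj₁ (x∈B , x∉W) = x∈p∪q⁺ (inj₁ (x∈p∧x≢y⇒x∈p-y
          (x∈p─q∪q─p⁺ (inj₁ (x∈B , x∉W ∘ V⊆W))) (λ { refl → x∉W (x∈p∪q⁺ (inj₁ (x∈⁅x⁆ a))) })))
  ... | inj₂ (x∈W , x∉B) with W⁻ x∈W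
  ...   | inj₁ refl        = ⊥-elim (x∉B a∈B)
  ...   | inj₂ (inj₁ refl) = y∈p∪⁅y⁆ _ b
  ...   | inj₂ (inj₂ x∈V)  = x∈p∪q⁺ (inj₁ (x∈p∧x≢y⇒x∈p-y
          (x∈p─q∪q─p⁺ (inj₂ (x∈V , x∉B))) (λ { refl → x∉B a∈B })))
  from : (((B ─ V) ∪ (V ─ B)) - a) ∪ ⁅ b ⁆ ⊆ (B ─ W) ∪ (W ─ B)
  from {x} x∈ with x∈p-y∪⁅z⁆⁻ _ x∈
  ... | inj₂ refl = x∈p─q∪q─p⁺ (inj₂ (x∈p∪q⁺ (inj₂ (x∈p∪q⁺ (inj₁ (x∈⁅x⁆ b)))) , b∉B))
  ... | inj₁ (x∈Δ , x≢a) with x∈p─q∪q─p⁻ B V x∈Δ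
  ...   | inj₂ (x∈V , x∉B) = x∈p─q∪q─p⁺ (inj₂ (V⊆W x∈V , x∉B))
  ...   | inj₁ (x∈B , x∉V) = x∈p─q∪q─p⁺ (inj₁ (x∈B , x∉W))
    where
    x∉W : x ∉ W
    x∉W x∈W with W⁻ x∈W
    ... | inj₁ x≡a         = x≢a x≡a
    ... | inj₂ (inj₁ refl) = b∉B x∈B
    ... | inj₂ (inj₂ x∈V)  = x∉V x∈V

⊂⇒⊊ : p ⊂ q → p ⊊ q
⊂⇒⊊ (p⊆q , _ , x∈q , x∉p) = p⊆q , λ { refl → x∉p x∈q }

module _ (M : Matroid n) where

  basis-maximal : IsBasis M B → Indep M (B ∪ ⁅ e ⁆) → e ∈ B
  basis-maximal {B = B} {e = e} (_ , maximal) ind = maximal _ ind (p⊆p∪q ⁅ e ⁆) (y∈p∪⁅y⁆ B e)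

  ∣basis∣≮∣indep∣ : IsBasis M B → Indep M X → ¬ ∣ B ∣ < ∣ X ∣
  ∣basis∣≮∣indep∣ bB iX ∣B∣<∣X∣ with augment M (proj₁ bB) iX ∣B∣<∣X∣
  ... | _ , _ , e∉B , ind = e∉B (basis-maximal bB ind)

  ∣indep∣≤∣basis∣ : IsBasis M B → Indep M X → ∣ X ∣ ≤ ∣ B ∣
  ∣indep∣≤∣basis∣ bB iX = ≮⇒≥ (∣basis∣≮∣indep∣ bB iX)

  ∣basis∣≤∣indep∣⇒basis : IsBasis M B → Indep M X → ∣ B ∣ ≤ ∣ X ∣ → IsBasis M X
  ∣basis∣≤∣indep∣⇒basis {X = X} bB iX ∣B∣≤∣X∣ = iX , maximal
    where
    maximal : ∀ Y → Indep M Y → X ⊆ Y → Y ⊆ X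
    maximal Y iY X⊆Y {y} y∈Y with y ∈? X
    ... | yes y∈X = y∈X
    ... | no  y∉X = ⊥-elim (∣basis∣≮∣indep∣ bB iY
                      (≤-<-trans ∣B∣≤∣X∣ (p⊂q⇒∣p∣<∣q∣ (X⊆Y , y , y∈Y , y∉X))))

  indep-exchange⇒basis : IsBasis M S → a ∈ S → e ∉ S - a → Indep M ((S - a) ∪ ⁅ e ⁆) →
                         IsBasis M ((S - a) ∪ ⁅ e ⁆)
  indep-exchange⇒basis {S = S} {a = a} {e = e} bS a∈S e∉S-a ind =
    ∣basis∣≤∣indep∣⇒basis bS ind (≤-trans (≤-reflexive (∣p∣≡1+∣p-x∣ a∈S))
      (p⊂q⇒∣p∣<∣q∣ (p⊆p∪q ⁅ e ⁆ , e , y∈p∪⁅y⁆ (S - a) e , e∉S-a)))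

  -- If augmenting S - a from B - a + b adds some e ≠ b, then e ∈ B, and augmenting B - a from
  -- the basis S - a + e adds the alternative.
  transfer-exchange-or-alternative :
    IsBasis M B → IsBasis M S → a ∈ B → a ∈ S → IsBasis M ((B - a) ∪ ⁅ b ⁆) →
    IsBasis M ((S - a) ∪ ⁅ b ⁆) ⊎ ∃ λ e → e ∈ S × e ∉ B × IsBasis M ((B - a) ∪ ⁅ e ⁆)
  transfer-exchange-or-alternative {B = B} {S = S} {a = a} {b = b} bB bS a∈B a∈S bBab
    with augment M (hereditary M (p─q⊆p S ⁅ a ⁆) (proj₁ bS)) (proj₁ bBab)
           (<-≤-trans (x∈p⇒∣p-x∣<∣p∣ a∈S) (∣indep∣≤∣basis∣ bBab (proj₁ bS)))
  ... | e , e∈Bab , e∉S-a , ind with e ≟ b | x∈p-y∪⁅z⁆⁻ B e∈Bab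
  ...   | yes refl | _                = inj₁ (indep-exchange⇒basis bS a∈S e∉S-a ind)
  ...   | no  e≢b  | inj₂ e≡b         = ⊥-elim (e≢b e≡b)
  ...   | no  _    | inj₁ (e∈B , e≢a) = inj₂ (alternative (augment M
            (hereditary M (p─q⊆p B ⁅ a ⁆) (proj₁ bB)) (proj₁ bT)
            (<-≤-trans (x∈p⇒∣p-x∣<∣p∣ a∈B) (∣indep∣≤∣basis∣ bT (proj₁ bB)))))
    where
    T = (S - a) ∪ ⁅ e ⁆
    bT : IsBasis M T
    bT = indep-exchange⇒basis bS a∈S e∉S-a ind
    alternative : (∃ λ e′ → e′ ∈ T × e′ ∉ B - a × Indep M ((B - a) ∪ ⁅ e′ ⁆)) →
                  ∃ λ e′ → e′ ∈ S × e′ ∉ B × IsBasis M ((B - a) ∪ ⁅ e′ ⁆)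
    alternative (e′ , e′∈T , e′∉B-a , ind′) with x∈p-y∪⁅z⁆⁻ S e′∈T
    ... | inj₂ refl          = ⊥-elim (e′∉B-a (x∈p∧x≢y⇒x∈p-y e∈B e≢a))
    ... | inj₁ (e′∈S , e′≢a) = e′ , e′∈S , (λ e′∈B → e′∉B-a (x∈p∧x≢y⇒x∈p-y e′∈B e′≢a)) ,
                               indep-exchange⇒basis bB a∈B e′∉B-a ind′

module _ {R : A → A → Set} where

  AllPairs-resp-⊑ : ys ⊑ xs → AllPairs R xs → AllPairs R ys
  AllPairs-resp-⊑ []               []         = []
  AllPairs-resp-⊑ (_ Sublist.∷ʳ σ) (_ ∷ pxs)  = AllPairs-resp-⊑ σ pxs
  AllPairs-resp-⊑ (refl ∷ σ)       (px ∷ pxs) = All-resp-⊆ σ px ∷ AllPairs-resp-⊑ σ pxs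

  Linked-∷ʳ⁺ : ∀ xs → Linked R (xs ∷ʳ x) → R x y → Linked R (xs ∷ʳ x ∷ʳ y)
  Linked-∷ʳ⁺ []            _        r = r ∷ [-]
  Linked-∷ʳ⁺ (_ ∷ [])      (r₀ ∷ _) r = r₀ ∷ r ∷ [-]
  Linked-∷ʳ⁺ (_ ∷ x′ ∷ xs) (r₀ ∷ l) r = r₀ ∷ Linked-∷ʳ⁺ (x′ ∷ xs) l r

  Linked-drop : ∀ xs → Linked R ((xs ++ ys) ∷ʳ h) → Linked R (ys ∷ʳ h)
  Linked-drop []       l = l
  Linked-drop (_ ∷ xs) l = Linked-drop xs (Linked.tail l)

  Linked-bypass : ∀ pre → Linked R ((pre ++ a ∷ b ∷ mid ++ b′ ∷ post) ∷ʳ h) → R a b′ →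
                  Linked R ((pre ++ a ∷ b′ ∷ post) ∷ʳ h)
  Linked-bypass {mid = mid} [] (_ ∷ l)  r = r ∷ Linked-drop mid (Linked.tail l)
  Linked-bypass (_ ∷ [])      (r₀ ∷ l) r = r₀ ∷ Linked-bypass [] l r
  Linked-bypass (_ ∷ p ∷ pre) (r₀ ∷ l) r = r₀ ∷ Linked-bypass (p ∷ pre) l r

bypass-⊑ : ∀ pre → pre ++ a ∷ b′ ∷ post ⊑ pre ++ a ∷ b ∷ mid ++ b′ ∷ post
bypass-⊑ {b = b} {mid = mid} pre = ++⁺ ⊑-refl (refl ∷ (b Sublist.∷ʳ ++⁺ˡ mid ⊑-refl))

bypassed∉ : ∀ pre → Unique (pre ++ a ∷ b ∷ mid ++ b′ ∷ post) → b ∉ₗ pre ++ a ∷ b′ ∷ post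
bypassed∉ []             ((a≢b ∷ _) ∷ _) (here refl) = a≢b refl
bypassed∉ {mid = mid} [] (_ ∷ u)         (there m)   = Unique[x∷xs]⇒x∉xs u (∈-++⁺ʳ mid m)
bypassed∉ (_ ∷ pre)      u               (here refl) =
  Unique[x∷xs]⇒x∉xs u (∈-++⁺ʳ pre (there (here refl)))
bypassed∉ (_ ∷ pre)      (_ ∷ u)         (there m)   = bypassed∉ pre u m

last∈suffix : ∀ xs → xs ++ y ∷ ys ≡ ws ∷ʳ t → t ∈ₗ y ∷ ys
last∈suffix {ws = ws}    []          eq = subst (_ ∈ₗ_) (sym eq) (∈-++⁺ʳ ws (here refl))
last∈suffix {ws = _ ∷ _} (_ ∷ xs)    eq = last∈suffix xs (∷-injectiveʳ eq)
last∈suffix {ws = []}    (_ ∷ [])    ()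
last∈suffix {ws = []}    (_ ∷ _ ∷ _) ()

Endpoint : A → List A → Set
Endpoint t xs = (∃ λ ws → xs ≡ t ∷ ws) ⊎ (∃ λ ws → xs ≡ ws ∷ʳ t)

bypass-keeps-endpoint : ∀ pre → Endpoint t (pre ++ a ∷ b ∷ mid ++ b′ ∷ post) →
                        t ∈ₗ pre ++ a ∷ b′ ∷ post
bypass-keeps-endpoint []      (inj₁ (_ , refl)) = here refl
bypass-keeps-endpoint (_ ∷ _) (inj₁ (_ , refl)) = here refl
bypass-keeps-endpoint {a = a} {b = b} {mid = mid} {b′ = b′} {post = post} pre (inj₂ (_ , eq)) =
  ∈-++⁺ʳ pre (there (last∈suffix (pre ++ a ∷ b ∷ mid)
                                  (trans (++-assoc pre (a ∷ b ∷ mid) (b′ ∷ post)) eq)))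

∈-VSet⁺ : {xs : List (Fin n)} → x ∈ₗ xs → x ∈ VSet xs
∈-VSet⁺ {xs = x ∷ _} (here refl) = x∈p∪q⁺ (inj₁ (x∈⁅x⁆ x))
∈-VSet⁺              (there m)   = x∈p∪q⁺ (inj₂ (∈-VSet⁺ m))

∈-VSet⁻ : ∀ (xs : List (Fin n)) → x ∈ VSet xs → x ∈ₗ xs
∈-VSet⁻ []       x∈ = ⊥-elim (∉⊥ x∈)
∈-VSet⁻ (y ∷ xs) x∈ with x∈p∪q⁻ ⁅ y ⁆ (VSet xs) x∈
... | inj₁ x∈⁅y⁆ = here (x∈⁅y⁆⇒x≡y y x∈⁅y⁆)
... | inj₂ x∈xs  = there (∈-VSet⁻ xs x∈xs)

VSet-mono : {xs ys : List (Fin n)} → xs ⊑ ys → VSet xs ⊆ VSet ys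
VSet-mono {xs = xs} σ = ∈-VSet⁺ ∘ Any-resp-⊆ σ ∘ ∈-VSet⁻ xs

VSet-++ : ∀ (xs ys : List (Fin n)) → VSet (xs ++ ys) ≡ VSet xs ∪ VSet ys
VSet-++ []       ys = sym (∪-identityˡ (VSet ys))
VSet-++ (x ∷ xs) ys =
  trans (cong (⁅ x ⁆ ∪_) (VSet-++ xs ys)) (sym (∪-assoc ⁅ x ⁆ (VSet xs) (VSet ys)))

VSet-++-comm : ∀ (xs ys : List (Fin n)) → VSet (xs ++ ys) ≡ VSet (ys ++ xs)
VSet-++-comm xs ys = begin
  VSet (xs ++ ys)    ≡⟨ VSet-++ xs ys ⟩
  VSet xs ∪ VSet ys  ≡⟨ ∪-comm (VSet xs) (VSet ys) ⟩
  VSet ys ∪ VSet xs  ≡⟨ VSet-++ ys xs ⟨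
  VSet (ys ++ xs)    ∎
  where open ≡-Reasoning

module _ {R : Fin n → Fin n → Set} where

  IsCycle⇒Unique : IsCycle R C → Unique C
  IsCycle⇒Unique {C = _ ∷ _} (u , _) = u

  IsCycle-map : ∀ {S : Fin n → Fin n → Set} → (∀ {u v} → R u v → S u v) → IsCycle R C → IsCycle S C
  IsCycle-map {C = _ ∷ _} f (u , l) = u , Linked.map f l

  IsCycle-out : IsCycle R C → x ∈ₗ C → ∃ (R x)
  IsCycle-out {C = c ∷ C} (_ , l) = out (c ∷ C) l
    where
    out : ∀ xs → Linked R (xs ∷ʳ h) → x ∈ₗ xs → ∃ (R x)
    out (_ ∷ [])     (r ∷ _) (here refl) = _ , r
    out (_ ∷ _ ∷ _)  (r ∷ _) (here refl) = _ , r
    out (_ ∷ y ∷ xs) (_ ∷ l) (there m)   = out (y ∷ xs) l m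

  IsCycle-rotate₁ : ∀ x xs → IsCycle R (x ∷ xs) → IsCycle R (xs ∷ʳ x)
  IsCycle-rotate₁ x []       c           = c
  IsCycle-rotate₁ x (y ∷ ys) (u , r ∷ l) =
    Permutation.Unique-resp-↭ (setoid _) (Permutation.++-comm (setoid _) [ x ] (y ∷ ys)) u ,
    Linked-∷ʳ⁺ (y ∷ ys) l r

  IsCycle-rotate : ∀ xs ys → IsCycle R (xs ++ ys) → IsCycle R (ys ++ xs)
  IsCycle-rotate []       ys c = subst (IsCycle R) (sym (++-identityʳ ys)) c
  IsCycle-rotate (x ∷ xs) ys c =
    subst (IsCycle R) (++-assoc ys [ x ] xs)
      (IsCycle-rotate xs (ys ∷ʳ x)
        (subst (IsCycle R) (++-assoc xs ys [ x ]) (IsCycle-rotate₁ x (xs ++ ys) c)))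

  IsCycle-bypass : ∀ pre → IsCycle R (pre ++ a ∷ b ∷ mid ++ b′ ∷ post) → R a b′ →
                   IsCycle R (pre ++ a ∷ b′ ∷ post)
  IsCycle-bypass []        (u , l) r = AllPairs-resp-⊑ (bypass-⊑ []) u , Linked-bypass [] l r
  IsCycle-bypass (p ∷ pre) (u , l) r =
    AllPairs-resp-⊑ (bypass-⊑ (p ∷ pre)) u , Linked-bypass (p ∷ pre) l r

data Shortcut (R : Fin n → Fin n → Set) : List (Fin n) → Set where
  bypass : ∀ pre {a b mid b′ post} → R a b′ → Shortcut R (pre ++ a ∷ b ∷ mid ++ b′ ∷ post)

chord⇒Shortcut : ∀ {R : Fin n → Fin n → Set} {a b b′} → b′ ∈ₗ L → R a b′ → Shortcut R (a ∷ b ∷ L)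
chord⇒Shortcut b′∈L r with ∈-∃++ b′∈L
... | _ , _ , refl = bypass [] r

SmallerCycle : (Fin n → Fin n → Set) → Fin n → Subset n → Set
SmallerCycle R t V = ∃ λ C′ → IsCycle R C′ × t ∈ VSet C′ × VSet C′ ⊂ V

SmallerCycle-map : ∀ {R S : Fin n → Fin n → Set} {t} → (∀ {u v} → R u v → S u v) →
                   SmallerCycle R t V → SmallerCycle S t V
SmallerCycle-map f (C′ , c , rest) = C′ , IsCycle-map f c , rest

Shortcut⇒SmallerCycle : ∀ {R : Fin n → Fin n → Set} {t} → IsCycle R L → Shortcut R L →
                        Endpoint t L → SmallerCycle R t (VSet L)
Shortcut⇒SmallerCycle c (bypass pre {b = b} r) t-end =
  _ , IsCycle-bypass pre c r , ∈-VSet⁺ (bypass-keeps-endpoint pre t-end) ,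
  VSet-mono (bypass-⊑ pre) , b , ∈-VSet⁺ (∈-++⁺ʳ pre (there (here refl))) ,
  bypassed∉ pre (IsCycle⇒Unique c) ∘ ∈-VSet⁻ _

module _ (M : Matroid n) {B B′ : Subset n} where

  cycle-vertex-side : IsCycle (DEdge M B B′) C → x ∈ₗ C → x ∈ B ⊎ x ∈ B′
  cycle-vertex-side c = Sum.map proj₁ proj₁ ∘ proj₂ ∘ IsCycle-out c

  VSet-cycle⊆ : IsCycle (DEdge M B B′) C → VSet C ⊆ B ∪ B′
  VSet-cycle⊆ {C = C} c = x∈p∪q⁺ ∘ cycle-vertex-side c ∘ ∈-VSet⁻ C

module _ (M : Matroid n) {B B′ : Subset n} (∈B⇒∉B′ : ∀ {x} → x ∈ B → x ∉ B′) where

  ExchangePair : Fin n → Fin n → Set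
  ExchangePair a b = a ∈ B × b ∈ B′ × IsBasis M ((B - a) ∪ ⁅ b ⁆)

  data Matching : List (Fin n) → Set where
    []  : Matching []
    _∷_ : ∀ {a b L} → ExchangePair a b → Matching L → Matching (a ∷ b ∷ L)

  Matching-sides : Matching L → x ∈ₗ L → x ∈ B ⊎ x ∈ B′
  Matching-sides ((a∈B , _) ∷ _)      (here refl)         = inj₁ a∈B
  Matching-sides ((_ , b∈B′ , _) ∷ _) (there (here refl)) = inj₂ b∈B′
  Matching-sides (_ ∷ m)              (there (there x∈L)) = Matching-sides m x∈L

  edge-from-B : x ∈ B → DEdge M B B′ x y → ExchangePair x y
  edge-from-B _   (inj₁ pair)       = pair
  edge-from-B x∈B (inj₂ (x∈B′ , _)) = ⊥-elim (∈B⇒∉B′ x∈B x∈B′)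

  edge-from-B′ : x ∈ B′ → DEdge M B B′ x y → y ∈ B
  edge-from-B′ x∈B′ (inj₁ (x∈B , _))     = ⊥-elim (∈B⇒∉B′ x∈B x∈B′)
  edge-from-B′ _    (inj₂ (_ , y∈B , _)) = y∈B

  closed-walk⇒Matching : x ∈ B → h ∈ B → Linked (DEdge M B B′) ((x ∷ L) ∷ʳ h) → Matching (x ∷ L)
  closed-walk⇒Matching {L = []}        x∈B h∈B (e ∷ _) =
    ⊥-elim (∈B⇒∉B′ h∈B (proj₁ (proj₂ (edge-from-B x∈B e))))
  closed-walk⇒Matching {L = _ ∷ []}    x∈B _   (e ∷ _) = edge-from-B x∈B e ∷ []
  closed-walk⇒Matching {L = _ ∷ _ ∷ _} x∈B h∈B (e ∷ e′ ∷ l) =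
    pair ∷ closed-walk⇒Matching (edge-from-B′ (proj₁ (proj₂ pair)) e′) h∈B l
    where pair = edge-from-B x∈B e

  Δ-step : IsBasis M B → ExchangePair a b → Matching L → Unique (a ∷ b ∷ L) →
           IsBasis M (_Δ_ M B (VSet L)) →
           IsBasis M (_Δ_ M B (VSet (a ∷ b ∷ L))) ⊎ Shortcut (DEdge M B B′) (a ∷ b ∷ L)
  Δ-step {L = L} bB (a∈B , b∈B′ , bBab) m u bS
    with transfer-exchange-or-alternative M bB bS a∈B
           (x∈p─q∪q─p⁺ (inj₁ (a∈B , Unique[x∷xs]⇒x∉xs u ∘ there ∘ ∈-VSet⁻ L))) bBab
  ... | inj₁ bS′ = inj₁ (subst (IsBasis M) (sym (Δ-insert-pair a∈B (λ b∈B → ∈B⇒∉B′ b∈B b∈B′))) bS′)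
  ... | inj₂ (e , e∈S , e∉B , bBae) with x∈p─q∪q─p⁻ B (VSet L) e∈S
  ...   | inj₁ (e∈B , _) = ⊥-elim (e∉B e∈B)
  ...   | inj₂ (e∈V , _) with Matching-sides m (∈-VSet⁻ L e∈V)
  ...     | inj₁ e∈B  = ⊥-elim (e∉B e∈B)
  ...     | inj₂ e∈B′ = inj₂ (chord⇒Shortcut (∈-VSet⁻ L e∈V) (inj₁ (a∈B , e∈B′ , bBae)))

  Matching⇒Δ-basis-or-Shortcut : IsBasis M B → Matching L → Unique L →
                                 IsBasis M (_Δ_ M B (VSet L)) ⊎ Shortcut (DEdge M B B′) L
  Matching⇒Δ-basis-or-Shortcut bB [] _ = inj₁ (subst (IsBasis M) (sym (p─⊥∪⊥─p≡p B)) bB)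
  Matching⇒Δ-basis-or-Shortcut bB (pair ∷ m) u@(_ ∷ _ ∷ u′)
    with Matching⇒Δ-basis-or-Shortcut bB m u′
  ... | inj₁ bS             = Δ-step bB pair m u bS
  ... | inj₂ (bypass pre r) = inj₂ (bypass (_ ∷ _ ∷ pre) r)

  IsCycle⇒Δ-basis-or-Shortcut : IsBasis M B → x ∈ B → IsCycle (DEdge M B B′) (x ∷ L) →
                                IsBasis M (_Δ_ M B (VSet (x ∷ L))) ⊎ Shortcut (DEdge M B B′) (x ∷ L)
  IsCycle⇒Δ-basis-or-Shortcut bB x∈B (u , l) =
    Matching⇒Δ-basis-or-Shortcut bB (closed-walk⇒Matching x∈B x∈B l) u

module _ (M : Matroid n) {B B′ : Subset n} (bB : IsBasis M B) (bB′ : IsBasis M B′)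
         (∈B⇒∉B′ : ∀ {x} → x ∈ B → x ∉ B′) where

  private
    R = DEdge M B B′

  ΔBases : Subset n → Set
  ΔBases V = IsBasis M (_Δ_ M B V) × IsBasis M (_Δ_ M B′ V)

  BΔV-basis-or-smaller : t ∈ B → IsCycle R (t ∷ ws) →
                         IsBasis M (_Δ_ M B (VSet (t ∷ ws))) ⊎ SmallerCycle R t (VSet (t ∷ ws))
  BΔV-basis-or-smaller t∈B c =
    Sum.map₂ (λ s → Shortcut⇒SmallerCycle c s (inj₁ (_ , refl)))
             (IsCycle⇒Δ-basis-or-Shortcut M ∈B⇒∉B′ bB t∈B c)

  B′ΔV-basis-or-smaller : t ∈ B → IsCycle R (t ∷ ws) →
                          IsBasis M (_Δ_ M B′ (VSet (t ∷ ws))) ⊎ SmallerCycle R t (VSet (t ∷ ws))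
  B′ΔV-basis-or-smaller {ws = []} t∈B (_ , e ∷ _) =
    ⊥-elim (∈B⇒∉B′ t∈B (proj₁ (proj₂ (edge-from-B M ∈B⇒∉B′ t∈B e))))
  B′ΔV-basis-or-smaller {t = t} {ws = w ∷ ws} t∈B c@(_ , e ∷ _) =
    Sum.map (subst (λ V → IsBasis M (_Δ_ M B′ V)) V≡)
            (λ s → subst (SmallerCycle R t) V≡
                     (SmallerCycle-map Sum.swap (Shortcut⇒SmallerCycle c′ s (inj₂ (w ∷ ws , refl)))))
            (IsCycle⇒Δ-basis-or-Shortcut M (λ x∈B′ x∈B → ∈B⇒∉B′ x∈B x∈B′) bB′ w∈B′ c′)
    where
    w∈B′ : w ∈ B′
    w∈B′ = proj₁ (proj₂ (edge-from-B M ∈B⇒∉B′ t∈B e))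
    c′ : IsCycle (DEdge M B′ B) ((w ∷ ws) ∷ʳ t)
    c′ = IsCycle-map Sum.swap (IsCycle-rotate₁ t (w ∷ ws) c)
    V≡ : VSet ((w ∷ ws) ∷ʳ t) ≡ VSet (t ∷ w ∷ ws)
    V≡ = VSet-++-comm (w ∷ ws) [ t ]

  ΔBases-or-smaller-at-head : t ∈ B → IsCycle R (t ∷ ws) →
                              ΔBases (VSet (t ∷ ws)) ⊎ SmallerCycle R t (VSet (t ∷ ws))
  ΔBases-or-smaller-at-head t∈B c with BΔV-basis-or-smaller t∈B c | B′ΔV-basis-or-smaller t∈B c
  ... | inj₂ s  | _       = inj₂ s
  ... | inj₁ _  | inj₂ s  = inj₂ s
  ... | inj₁ β₁ | inj₁ β₂ = inj₁ (β₁ , β₂)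

  ΔBases-or-smaller : IsCycle R C → t ∈ₗ C → t ∈ B → ΔBases (VSet C) ⊎ SmallerCycle R t (VSet C)
  ΔBases-or-smaller {t = t} c t∈C t∈B with ∈-∃++ t∈C
  ... | pre , post , refl = Sum.map (subst ΔBases V≡) (subst (SmallerCycle R t) V≡)
                              (ΔBases-or-smaller-at-head t∈B (IsCycle-rotate pre (t ∷ post) c))
    where V≡ = VSet-++-comm (t ∷ post) pre

module _ (M : Matroid n) {B₁ B₂ : Subset n} (b₁ : IsBasis M B₁) (b₂ : IsBasis M B₂)
         (disjoint : Disjoint B₁ B₂) where

  private
    R = DEdge M B₁ B₂

    ∈B₁⇒∉B₂ : x ∈ B₁ → x ∉ B₂
    ∈B₁⇒∉B₂ x∈B₁ x∈B₂ = disjoint (_ , x∈p∩q⁺ (x∈B₁ , x∈B₂))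

  exchangeable-or-smaller : IsCycle R C → t ∈ VSet C →
                            Exchangeable M B₁ B₂ (VSet C) ⊎ SmallerCycle R t (VSet C)
  exchangeable-or-smaller {C = C} c t∈V with cycle-vertex-side M c (∈-VSet⁻ C t∈V)
  ... | inj₁ t∈B₁ = Sum.map (λ β → VSet-cycle⊆ M c , β) id
                      (ΔBases-or-smaller M b₁ b₂ ∈B₁⇒∉B₂ c (∈-VSet⁻ C t∈V) t∈B₁)
  ... | inj₂ t∈B₂ = Sum.map (λ β → VSet-cycle⊆ M c , Product.swap β) (SmallerCycle-map Sum.swap)
                      (ΔBases-or-smaller M b₂ b₁ (λ x∈B₂ x∈B₁ → ∈B₁⇒∉B₂ x∈B₁ x∈B₂)
                        (IsCycle-map Sum.swap c) (∈-VSet⁻ C t∈V) t∈B₂)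

  exchangeable-within : Acc _<_ ∣ VSet C ∣ → IsCycle R C → t ∈ VSet C →
                        ∃ λ U → U ⊆ VSet C × t ∈ U × Exchangeable M B₁ B₂ U
  exchangeable-within {C = C} (acc smaller) c t∈V with exchangeable-or-smaller c t∈V
  ... | inj₁ ex = VSet C , ⊆-refl , t∈V , ex
  ... | inj₂ (C′ , c′ , t∈V′ , V′⊂V) with exchangeable-within (smaller (p⊂q⇒∣p∣<∣q∣ V′⊂V)) c′ t∈V′
  ...   | U , U⊆V′ , t∈U , ex = U , ⊆-trans U⊆V′ (proj₁ V′⊂V) , t∈U , ex

  minimal⇒exchangeable : IsCycle R C → t ∈ VSet C →
                         ¬ (∃ λ C′ → IsCycle R C′ × t ∈ VSet C′ × VSet C′ ⊊ VSet C) →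
                         Exchangeable M B₁ B₂ (VSet C)
  minimal⇒exchangeable c t∈V no-smaller with exchangeable-or-smaller c t∈V
  ... | inj₁ ex                      = ex
  ... | inj₂ (C′ , c′ , t∈V′ , V′⊂V) = ⊥-elim (no-smaller (C′ , c′ , t∈V′ , ⊂⇒⊊ V′⊂V))

lemma3p2 : {n : ℕ} (M : Matroid n) (B₁ B₂ : Subset n) →
  IsBasis M B₁ → IsBasis M B₂ → Disjoint B₁ B₂ →
  (C : List (Fin n)) → IsCycle (DEdge M B₁ B₂) C →
  (t : Fin n) → t ∈ VSet C →
  (∃ λ U → U ⊆ VSet C × t ∈ U × Exchangeable M B₁ B₂ U)
  × ((¬ ∃ λ C′ → IsCycle (DEdge M B₁ B₂) C′ × t ∈ VSet C′ × VSet C′ ⊊ VSet C)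
     → Exchangeable M B₁ B₂ (VSet C))
lemma3p2 M B₁ B₂ b₁ b₂ disjoint C c t t∈V =
  exchangeable-within M b₁ b₂ disjoint (<-wellFounded _) c t∈V ,
  minimal⇒exchangeable M b₁ b₂ disjoint c t∈V
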